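{- Let $p$ be an odd prime and $\mathbf{S}(p)=(s^{(p)}_i)_{i\ge0}$ the $p$-Singer sequence. For every positive integer $k$ and every $0\le i\le p^k+1$, $s^{(p)}_i=s^{(p)}_{p^k+1-i}$.
   Context: $p_2=(p-1)/2$. For real $a,b$, $\binom{a}{b}=\frac{a!}{b!(a-b)!}$ if $a,b$ are nonnegative integers with $a\ge b$, and $0$ otherwise. Let $\varphi_p$ be the substitution on $\{0,\dots,p-1\}$ (identified with $\mathbb{F}_p$) sending each letter $n$ to the length-$p$ word with $i$-th letter $n\binom{p_2}{i}\bmod p$ ($0\le i\le p-1$), and let $\tau_p$ send each letter $n$ to the length-$2p$ word with $i$-th letter $n\binom{p_2+1}{i/2}\bmod p$ ($0\le i\le 2p-1$); both are extended to (infinite) words by concatenation. The pseudo-$p$-Singer sequence is $\lim_{k\to\infty}\varphi_p^k(1)$, and the $p$-Singer sequence is $\mathbf{S}(p)=\tau_p\big(\lim_{k\to\infty}\varphi_p^k(1)\big)$. -}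

module Defs where

open import Data.Nat using (ℕ; zero; suc; _+_; _*_; _^_; _%_; _/_; _≤_; _<_; _≟_; NonZero)
open import Data.Nat.Combinatorics using (_C_)

open import Data.List using (List; []; _∷_; map; concatMap; upTo)
open import Data.Maybe using (Maybe; just; nothing)
open import Data.Bool using (if_then_else_)
open import Relation.Nullary.Decidable using (⌊_⌋)
open import Data.Nat.Properties using (_≤?_)

-- Binomial with the paper's convention for a real lower argument: the lower
-- argument is given as a numerator/denominator pair (here i/2); it is 0 unless
-- the quotient is a natural number b ≤ a.  (n C k from stdlib is already 0 when k > n.)
-- binom-half a i  =  binom(a, i/2)  with i/2 read as a real number.
binom-half : ℕ → ℕ → ℕ
binom-half a i = if ⌊ i % 2 ≟ 0 ⌋ then a C (i / 2) else 0

half : ℕ → ℕ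
half p = p / 2   -- for odd p, (p - 1)/2 = ⌊p/2⌋

-- letters of 𝔽_p are represented by naturals, reduced mod p
-- φ_p on a letter n: the word (n * binom(p₂, i) mod p)_{0 ≤ i ≤ p-1}
φ-letter : (p : ℕ) .{{_ : NonZero p}} → ℕ → List ℕ
φ-letter p n = map (λ i → (n * (half p C i)) % p) (upTo p)

τ-letter : (p : ℕ) .{{_ : NonZero p}} → ℕ → List ℕ
τ-letter p n = map (λ i → (n * binom-half (suc (half p)) i) % p) (upTo (2 * p))

φ : (p : ℕ) .{{_ : NonZero p}} → List ℕ → List ℕ
φ p = concatMap (φ-letter p)

φ-iter : (p : ℕ) .{{_ : NonZero p}} → ℕ → List ℕ
φ-iter p zero    = 1 ∷ []
φ-iter p (suc k) = φ p (φ-iter p k)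

_!!_ : List ℕ → ℕ → Maybe ℕ
[]       !! _     = nothing
(x ∷ xs) !! zero  = just x
(x ∷ xs) !! suc n = xs !! n

-- Since φ_p(1) starts with 1, each φ_p^k(1) is a prefix of φ_p^{k+1}(1), and
-- φ_p^k(1) has length p^k > n once k = n+1 (p ≥ 2); the limit letter at
-- position n is therefore the n-th letter of φ_p^{n+1}(1).
pseudoSinger : (p : ℕ) .{{_ : NonZero p}} → ℕ → Maybe ℕ
pseudoSinger p n = φ-iter p (suc n) !! n

τ : (p : ℕ) .{{_ : NonZero p}} → List ℕ → List ℕ
τ p = concatMap (τ-letter p)

-- i-th letter of the p-Singer sequence S(p) = τ_p(lim_k φ_p^k(1)).
-- τ_p(φ_p^k(1)) is a prefix of S(p) of length 2p^{k+1}... more precisely 2p·p^k > i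
-- for k = i+1, so the i-th letter of S(p) is the i-th letter of τ_p(φ_p^{i+1}(1)).
singer : (p : ℕ) .{{_ : NonZero p}} → ℕ → Maybe ℕ
singer p i = τ p (φ-iter p (suc i)) !! i

-- The letter of lim φₚᵏ(1) at n is ∏ⱼ C(p₂, nⱼ) mod p over the base-p digits nⱼ of n, and the
-- letter of S(p) at 2n (resp. 2n+1) is the letter at ⌊n/p⌋ times C(p₂+1, n mod p) (resp. 0).
-- If every base-p digit of m + m' equals a < p, then either no carry occurs, so the digits pair
-- up as b + b' = a and C(a,b) = C(a,b'), or there is a first carry, at a digit with b + b' = p + a,
-- which forces b, b' > a and makes both products vanish.  Positions i, i' with
-- i + i' = p^k + 1 have the same parity, and i = 2n, i' = 2n' gives
-- n + n' = (p₂+1) + p·(p^(k-1) - 1)/2, whose lowest digit is p₂+1 and all others p₂; the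
-- dichotomy applied with a = p₂+1 and then a = p₂ yields the symmetry.

module Submission where

open import Defs
open import Data.Nat
  using ( ℕ; zero; suc; _+_; _*_; _∸_; _^_; _≤_; _<_; _≟_; NonZero; _%_; _/_; z≤n; s≤s
        ; nonTrivial⇒n>1; >-nonZero)
open import Data.Nat.Properties
open import Data.Nat.DivMod
open import Data.Nat.Divisibility using (m∣m*n; n∣m*n)
open import Data.Nat.Combinatorics using (_C_; nCk≡nC[n∸k]; k>n⇒nCk≡0)
open import Data.Nat.Primality using (Prime; prime⇒nonTrivial)
open import Data.Nat.Solver using (module +-*-Solver)
open import Data.List using (List; []; _∷_; _++_; length; map; concatMap; applyUpTo; upTo)
open import Data.List.Properties using (length-map; length-upTo)
open import Data.Maybe using (just)
open import Data.Product using (_×_; _,_; proj₁)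
open import Data.Sum using (_⊎_; inj₁; inj₂)
open import Function using (_∘_; id)
open import Relation.Nullary using (yes; no)
open import Relation.Nullary.Decidable using (⌊_⌋)
open import Data.Bool using (if_then_else_)
open import Relation.Binary.PropositionalEquality

open +-*-Solver using (solve; _:+_; _:*_; _:=_; con)

!!-++ˡ : ∀ xs ys {r} → r < length xs → (xs ++ ys) !! r ≡ xs !! r
!!-++ˡ (x ∷ xs) ys {zero}  _         = refl
!!-++ˡ (x ∷ xs) ys {suc r} (s≤s r<n) = !!-++ˡ xs ys r<n

!!-++ʳ : ∀ xs ys r → (xs ++ ys) !! (length xs + r) ≡ ys !! r
!!-++ʳ []       ys r = refl
!!-++ʳ (x ∷ xs) ys r = !!-++ʳ xs ys r

!!-map-applyUpTo : ∀ (g f : ℕ → ℕ) {n r} → r < n → map g (applyUpTo f n) !! r ≡ just (g (f r))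
!!-map-applyUpTo g f {suc n} {zero}  _         = refl
!!-map-applyUpTo g f {suc n} {suc r} (s≤s r<n) = !!-map-applyUpTo g (f ∘ suc) r<n

length-map-upTo : ∀ (g : ℕ → ℕ) n → length (map g (upTo n)) ≡ n
length-map-upTo g n = trans (length-map g (upTo n)) (length-upTo n)

module _ {f : ℕ → List ℕ} {L : ℕ} (length-f : ∀ x → length (f x) ≡ L) where

  !!-concatMap-+* : ∀ xs {m x} r → r < L → xs !! m ≡ just x →
                    concatMap f xs !! (r + m * L) ≡ f x !! r
  !!-concatMap-+* (y ∷ xs) {zero} r r<L refl =
    trans (cong (concatMap f (y ∷ xs) !!_) (+-identityʳ r))
      (!!-++ˡ (f y) (concatMap f xs) (subst (r <_) (sym (length-f y)) r<L))
  !!-concatMap-+* (y ∷ xs) {suc m} r r<L xs!!m =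
    trans (cong (concatMap f (y ∷ xs) !!_) shift)
      (trans (!!-++ʳ (f y) (concatMap f xs) (r + m * L)) (!!-concatMap-+* xs r r<L xs!!m))
    where
    shift : r + suc m * L ≡ length (f y) + (r + m * L)
    shift = trans (+-comm r (L + m * L)) (trans (+-assoc L (m * L) r)
              (cong₂ _+_ (sym (length-f y)) (+-comm (m * L) r)))

  !!-concatMap : .{{_ : NonZero L}} → ∀ xs n {x} → xs !! (n / L) ≡ just x →
                 concatMap f xs !! n ≡ f x !! (n % L)
  !!-concatMap xs n xs!!n/L =
    trans (cong (concatMap f xs !!_) (m≡m%n+[m/n]*n n L))
      (!!-concatMap-+* xs (n % L) (m%n<n n L) xs!!n/L)

n<m^n : ∀ {m} → 1 < m → ∀ n → n < m ^ n
n<m^n {m} 1<m zero    = s≤s z≤n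
n<m^n {m} 1<m (suc n) = begin-strict
  suc n       ≤⟨ n<m^n 1<m n ⟩
  m ^ n       <⟨ m<m*n (m ^ n) m 1<m ⟩
  m ^ n * m   ≡⟨ *-comm (m ^ n) m ⟩
  m ^ suc n   ∎
  where
  open ≤-Reasoning
  instance _ = m^n≢0 m n {{>-nonZero (<-trans (s≤s z≤n) 1<m)}}

digit-unique : ∀ {d} .{{_ : NonZero d}} {r r' q q'} → r < d → r' < d →
               r + q * d ≡ r' + q' * d → r ≡ r' × q ≡ q'
digit-unique {d} {r} {r'} {q} {q'} r<d r'<d eq =
  trans (sym (remainder q r<d)) (trans (cong (_% d) eq) (remainder q' r'<d)) ,
  trans (sym (quotient q r<d)) (trans (cong (_/ d) eq) (quotient q' r'<d))
  where
  remainder : ∀ {r} q → r < d → (r + q * d) % d ≡ r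
  remainder {r} q r<d = trans ([m+kn]%n≡m%n r q d) (m<n⇒m%n≡m r<d)
  quotient : ∀ {r} q → r < d → (r + q * d) / d ≡ q
  quotient {r} q r<d =
    trans (+-distrib-/-∣ʳ r (n∣m*n q)) (cong₂ _+_ (m<n⇒m/n≡0 r<d) (m*n/n≡m q d))

+-%-/ : ∀ d .{{_ : NonZero d}} m m' → m + m' ≡ m % d + m' % d + (m / d + m' / d) * d
+-%-/ d m m' = trans (cong₂ _+_ (m≡m%n+[m/n]*n m d) (m≡m%n+[m/n]*n m' d))
  (solve 5 (λ r r' q q' d → r :+ q :* d :+ (r' :+ q' :* d) := r :+ r' :+ (q :+ q') :* d)
     refl (m % d) (m' % d) (m / d) (m' / d) d)

carry-split : ∀ d .{{_ : NonZero d}} m m' {c Q} → c < d → m + m' ≡ c + Q * d →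
              (m % d + m' % d ≡ c × m / d + m' / d ≡ Q) ⊎ m % d + m' % d ≡ d + c
carry-split d m m' {c} {Q} c<d eq with m % d + m' % d <? d
... | yes s<d = inj₁ (digit-unique {q = m / d + m' / d} {q' = Q} s<d c<d
                       (trans (sym (+-%-/ d m m')) eq))
... | no s≮d  = inj₂ (begin
  s           ≡⟨ m+[n∸m]≡n d≤s ⟨
  d + (s ∸ d) ≡⟨ cong (d +_) (proj₁ (digit-unique {q = suc (m / d + m' / d)} {q' = Q} t<d c<d
                   (trans (sym with-carry) eq))) ⟩
  d + c       ∎)
  where
  open ≡-Reasoning
  s = m % d + m' % d
  d≤s = ≮⇒≥ s≮d
  t<d : s ∸ d < d
  t<d = +-cancelˡ-< d (s ∸ d) d
          (subst (_< d + d) (sym (m+[n∸m]≡n d≤s)) (+-mono-< (m%n<n m d) (m%n<n m' d)))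
  with-carry : m + m' ≡ (s ∸ d) + suc (m / d + m' / d) * d
  with-carry = begin
    m + m'                              ≡⟨ +-%-/ d m m' ⟩
    s + (m / d + m' / d) * d            ≡⟨ cong (_+ (m / d + m' / d) * d) (m+[n∸m]≡n d≤s) ⟨
    d + (s ∸ d) + (m / d + m' / d) * d
      ≡⟨ solve 3 (λ d t q → d :+ t :+ q :* d := t :+ (con 1 :+ q) :* d)
           refl d (s ∸ d) (m / d + m' / d) ⟩
    (s ∸ d) + suc (m / d + m' / d) * d  ∎

m+n≡2⇒m≡1×n≡1 : ∀ {m n} → m < 2 → n < 2 → m + n ≡ 2 → m ≡ 1 × n ≡ 1
m+n≡2⇒m≡1×n≡1 {1}           {1}           _                _                _  = refl , refl
m+n≡2⇒m≡1×n≡1 {0}           {.2}          _                (s≤s (s≤s ()))   refl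
m+n≡2⇒m≡1×n≡1 {1}           {0}           _                _                ()
m+n≡2⇒m≡1×n≡1 {1}           {suc (suc _)} _                (s≤s (s≤s ()))   _
m+n≡2⇒m≡1×n≡1 {suc (suc _)} {_}           (s≤s (s≤s ()))   _                _

k+j≡n⇒nCk≡nCj : ∀ {n k j} → k + j ≡ n → n C k ≡ n C j
k+j≡n⇒nCk≡nCj {n} {k} {j} refl = trans (nCk≡nC[n∸k] (m≤m+n k j)) (cong (n C_) (m+n∸m≡n k j))

carry⇒digit> : ∀ {d b b' c} → b' < d → b + b' ≡ d + c → c < b
carry⇒digit> {d} {b} {b'} {c} b'<d eq =
  +-cancelʳ-< d c b (subst (_< b + d) (trans eq (+-comm d c)) (+-monoʳ-< b b'<d))

module _ (p : ℕ) .{{_ : NonZero p}} where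

  p₂ : ℕ
  p₂ = half p

  repdigit : ℕ → ℕ → ℕ
  repdigit a zero    = 0
  repdigit a (suc j) = a + repdigit a j * p

  digitBinomialProduct : ℕ → ℕ → ℕ → ℕ
  digitBinomialProduct a zero    n = 1
  digitBinomialProduct a (suc k) n = (digitBinomialProduct a k (n / p) * (a C (n % p))) % p

  repdigit<p^ : ∀ {a} → a < p → ∀ j → repdigit a j < p ^ j
  repdigit<p^ a<p zero    = s≤s z≤n
  repdigit<p^ {a} a<p (suc j) = begin-strict
    a + repdigit a j * p   <⟨ +-monoˡ-< (repdigit a j * p) a<p ⟩
    suc (repdigit a j) * p ≤⟨ *-monoˡ-≤ p (repdigit<p^ a<p j) ⟩
    p ^ j * p              ≡⟨ *-comm (p ^ j) p ⟩
    p ^ suc j              ∎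
    where open ≤-Reasoning

  p^≡1+repdigit*2 : ∀ {a} → p ≡ 1 + a * 2 → ∀ j → p ^ j ≡ 1 + repdigit a j * 2
  p^≡1+repdigit*2 {a} p-odd zero    = refl
  p^≡1+repdigit*2 {a} p-odd (suc j) = begin
    p * p ^ j                      ≡⟨ cong (p *_) (p^≡1+repdigit*2 p-odd j) ⟩
    p * (1 + repdigit a j * 2)
      ≡⟨ solve 2 (λ p r → p :* (con 1 :+ r :* con 2) := p :+ r :* p :* con 2)
           refl p (repdigit a j) ⟩
    p + repdigit a j * p * 2       ≡⟨ cong (_+ repdigit a j * p * 2) p-odd ⟩
    1 + a * 2 + repdigit a j * p * 2
      ≡⟨ solve 3 (λ a r p → con 1 :+ a :* con 2 :+ r :* p :* con 2
                           := con 1 :+ (a :+ r :* p) :* con 2) refl a (repdigit a j) p ⟩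
    1 + repdigit a (suc j) * 2     ∎
    where open ≡-Reasoning

  binomial-carry : ∀ {a m m' Q x x'} → a < p → m + m' ≡ a + Q * p →
                   (m / p + m' / p ≡ Q → x ≡ x') →
                   (x * (a C (m % p))) % p ≡ (x' * (a C (m' % p))) % p
  binomial-carry {a} {m} {m'} {Q} {x} {x'} a<p eq high with carry-split p m m' a<p eq
  ... | inj₁ (low , quotients) =
    cong₂ (λ y c → (y * c) % p) (high quotients) (k+j≡n⇒nCk≡nCj {k = m % p} low)
  ... | inj₂ carry             =
    trans (vanishes x (carry⇒digit> (m%n<n m' p) carry))
          (sym (vanishes x' (carry⇒digit> (m%n<n m p) (trans (+-comm (m' % p) (m % p)) carry))))
    where
    vanishes : ∀ y {b} → a < b → (y * (a C b)) % p ≡ 0 % p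
    vanishes y a<b = trans (cong (λ c → (y * c) % p) (k>n⇒nCk≡0 a<b)) (cong (_% p) (*-zeroʳ y))

  digitBinomialProduct-reflect : ∀ {a} → a < p → ∀ j m m' → m + m' ≡ repdigit a j →
                                 digitBinomialProduct a j m ≡ digitBinomialProduct a j m'
  digitBinomialProduct-reflect a<p zero    m m' _  = refl
  digitBinomialProduct-reflect a<p (suc j) m m' eq =
    binomial-carry a<p eq (digitBinomialProduct-reflect a<p j (m / p) (m' / p))

  φ-iter-!! : ∀ k {n} → n < p ^ k → φ-iter p k !! n ≡ just (digitBinomialProduct p₂ k n)
  φ-iter-!! zero    {zero}  _          = refl
  φ-iter-!! zero    {suc n} (s≤s ())
  φ-iter-!! (suc k) {n}     n<p^[1+k] = begin
    φ-iter p (suc k) !! n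
      ≡⟨ !!-concatMap (λ _ → length-map-upTo _ p) (φ-iter p k) n (φ-iter-!! k n/p<p^k) ⟩
    φ-letter p (digitBinomialProduct p₂ k (n / p)) !! (n % p)
      ≡⟨ !!-map-applyUpTo _ id (m%n<n n p) ⟩
    just (digitBinomialProduct p₂ (suc k) n) ∎
    where
    open ≡-Reasoning
    n/p<p^k = m<n*o⇒m/o<n (subst (n <_) (*-comm p (p ^ k)) n<p^[1+k])

  private instance
    2p≢0 : NonZero (2 * p)
    2p≢0 = m*n≢0 2 p
    p2≢0 : NonZero (p * 2)
    p2≢0 = m*n≢0 p 2

  %[2*p]%2≡%2 : ∀ i → i % (2 * p) % 2 ≡ i % 2
  %[2*p]%2≡%2 i = m∣n⇒o%n%m≡o%m 2 (2 * p) i (m∣m*n p)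

  binom-half-even : ∀ a {i} → i % 2 ≡ 0 → binom-half a (i % (2 * p)) ≡ a C (i / 2 % p)
  binom-half-even a {i} i-even = cong₂ (λ b c → if ⌊ b ≟ 0 ⌋ then a C c else 0)
    (trans (%[2*p]%2≡%2 i) i-even)
    (trans (cong (_/ 2) (%-congʳ (*-comm 2 p))) (m%[n*o]/o≡m/o%n i p 2))

  binom-half-odd : ∀ a {i} → i % 2 ≡ 1 → binom-half a (i % (2 * p)) ≡ 0
  binom-half-odd a {i} i-odd =
    cong (λ b → if ⌊ b ≟ 0 ⌋ then a C (i % (2 * p) / 2) else 0) (trans (%[2*p]%2≡%2 i) i-odd)

  singerAtDouble : ℕ → ℕ → ℕ
  singerAtDouble f n = (digitBinomialProduct p₂ f (n / p) * (suc p₂ C (n % p))) % p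

  module _ (1<p : 1 < p) where

    digitBinomialProduct-suc : ∀ {a} f {m} → m < p ^ f →
                               digitBinomialProduct a (suc f) m ≡ digitBinomialProduct a f m
    digitBinomialProduct-suc zero {zero} _ =
      trans (cong (λ r → (1 * (_ C r)) % p) (m<n⇒m%n≡m (<-trans (s≤s z≤n) 1<p))) (m<n⇒m%n≡m 1<p)
    digitBinomialProduct-suc zero {suc m} (s≤s ())
    digitBinomialProduct-suc {a} (suc f) {m} m<p^ = cong (λ x → (x * (a C (m % p))) % p)
      (digitBinomialProduct-suc f (m<n*o⇒m/o<n (subst (m <_) (*-comm p (p ^ f)) m<p^)))

    digitBinomialProduct-mono : ∀ {a f} g {m} → f ≤ g → m < p ^ f →
                                digitBinomialProduct a g m ≡ digitBinomialProduct a f m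
    digitBinomialProduct-mono zero    z≤n   _ = refl
    digitBinomialProduct-mono (suc g) f≤1+g m<p^ with m≤n⇒m<n∨m≡n f≤1+g
    ... | inj₂ refl       = refl
    ... | inj₁ (s≤s f≤g) = trans (digitBinomialProduct-suc g (<-≤-trans m<p^ (^-monoʳ-≤ p f≤g)))
                                 (digitBinomialProduct-mono g f≤g m<p^)

    digitBinomialProduct-stable : ∀ {a} f g {m} → m < p ^ f → m < p ^ g →
                                  digitBinomialProduct a f m ≡ digitBinomialProduct a g m
    digitBinomialProduct-stable f g m<p^f m<p^g with ≤-total f g
    ... | inj₁ f≤g = sym (digitBinomialProduct-mono g f≤g m<p^f)
    ... | inj₂ g≤f = digitBinomialProduct-mono f g≤f m<p^g

    digitBinomialProduct-reflect′ : ∀ {a} → a < p → ∀ j f g {m m'} → m + m' ≡ repdigit a j →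
                                    m < p ^ f → m' < p ^ g →
                                    digitBinomialProduct a f m ≡ digitBinomialProduct a g m'
    digitBinomialProduct-reflect′ {a} a<p j f g {m} {m'} eq m<p^f m'<p^g = begin
      digitBinomialProduct a f m  ≡⟨ digitBinomialProduct-stable f j m<p^f (≤-<-trans m≤r r<p^j) ⟩
      digitBinomialProduct a j m  ≡⟨ digitBinomialProduct-reflect a<p j m m' eq ⟩
      digitBinomialProduct a j m' ≡⟨ digitBinomialProduct-stable j g (≤-<-trans m'≤r r<p^j) m'<p^g ⟩
      digitBinomialProduct a g m' ∎
      where
      open ≡-Reasoning
      r<p^j = repdigit<p^ a<p j
      m≤r  = subst (m ≤_) eq (m≤m+n m m')
      m'≤r = subst (m' ≤_) eq (m≤n+m m' m)

    singer-!! : ∀ i → singer p i ≡ just ((digitBinomialProduct p₂ (suc i) (i / (2 * p))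
                                          * binom-half (suc p₂) (i % (2 * p))) % p)
    singer-!! i = begin
      τ p (φ-iter p (suc i)) !! i
        ≡⟨ !!-concatMap (λ _ → length-map-upTo _ (2 * p)) (φ-iter p (suc i)) i
             (φ-iter-!! (suc i) i/2p<p^[1+i]) ⟩
      τ-letter p (digitBinomialProduct p₂ (suc i) (i / (2 * p))) !! (i % (2 * p))
        ≡⟨ !!-map-applyUpTo _ id (m%n<n i (2 * p)) ⟩
      just _ ∎
      where
      open ≡-Reasoning
      i/2p<p^[1+i] = ≤-<-trans (m/n≤m i (2 * p)) (<-trans (n<1+n i) (n<m^n 1<p (suc i)))

    singer-even : ∀ i → i % 2 ≡ 0 → singer p i ≡ just (singerAtDouble (suc i) (i / 2))
    singer-even i i-even = trans (singer-!! i)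
      (cong₂ (λ q c → just ((digitBinomialProduct p₂ (suc i) q * c) % p))
        (sym (m/n/o≡m/[n*o] i 2 p)) (binom-half-even (suc p₂) i-even))

    singer-odd : ∀ i → i % 2 ≡ 1 → singer p i ≡ just 0
    singer-odd i i-odd = begin
      singer p i                                  ≡⟨ singer-!! i ⟩
      just ((x * binom-half (suc p₂) (i % (2 * p))) % p)
        ≡⟨ cong (λ c → just ((x * c) % p)) (binom-half-odd (suc p₂) i-odd) ⟩
      just ((x * 0) % p)                          ≡⟨ cong (λ y → just (y % p)) (*-zeroʳ x) ⟩
      just (0 % p)                                ≡⟨ cong just (m<n⇒m%n≡m (<-trans (s≤s z≤n) 1<p)) ⟩
      just 0                                      ∎
      where
      open ≡-Reasoning
      x = digitBinomialProduct p₂ (suc i) (i / (2 * p))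

    module _ (p-odd : p ≡ 1 + p₂ * 2) where

      1+p₂<p : suc p₂ < p
      1+p₂<p = subst (suc p₂ <_) (sym p-odd) (1+h<1+h*2 p₂ (subst (1 <_) p-odd 1<p))
        where
        1+h<1+h*2 : ∀ h → 1 < 1 + h * 2 → suc h < 1 + h * 2
        1+h<1+h*2 zero    (s≤s ())
        1+h<1+h*2 (suc h) _ = s≤s (s≤s (s≤s (m≤m*n h 2)))

      singer-reflect : ∀ k i i' → i + i' ≡ (suc p₂ + repdigit p₂ k * p) * 2 →
                       singer p i ≡ singer p i'
      singer-reflect k i i' eq with carry-split 2 i i' (s≤s z≤n) eq
      ... | inj₁ (even-sum , halves) = begin
        singer p i
          ≡⟨ singer-even i (m+n≡0⇒m≡0 (i % 2) even-sum) ⟩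
        just (singerAtDouble (suc i) (i / 2))
          ≡⟨ cong just (binomial-carry 1+p₂<p halves high-reflects) ⟩
        just (singerAtDouble (suc i') (i' / 2))
          ≡⟨ singer-even i' (m+n≡0⇒n≡0 (i % 2) even-sum) ⟨
        singer p i' ∎
        where
        open ≡-Reasoning
        bound : ∀ j → j / 2 / p < p ^ suc j
        bound j = ≤-<-trans (≤-trans (m/n≤m (j / 2) p) (m/n≤m j 2))
                            (<-trans (n<1+n j) (n<m^n 1<p (suc j)))
        high-reflects : i / 2 / p + i' / 2 / p ≡ repdigit p₂ k →
                        digitBinomialProduct p₂ (suc i) (i / 2 / p)
                          ≡ digitBinomialProduct p₂ (suc i') (i' / 2 / p)
        high-reflects high = digitBinomialProduct-reflect′ (<-trans (n<1+n p₂) 1+p₂<p) k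
                               (suc i) (suc i') high (bound i) (bound i')
      ... | inj₂ odd-sum with m+n≡2⇒m≡1×n≡1 (m%n<n i 2) (m%n<n i' 2) odd-sum
      ... | i-odd , i'-odd = trans (singer-odd i i-odd) (sym (singer-odd i' i'-odd))

lemma3p10 : (p : ℕ) .{{_ : NonZero p}} → Prime p → p % 2 ≡ 1 →
    (k : ℕ) → 1 ≤ k → (i : ℕ) → i ≤ p ^ k + 1 →
    singer p i ≡ singer p (p ^ k + 1 ∸ i)
lemma3p10 p p-prime p%2≡1 (suc k) _ i i≤ = singer-reflect p 1<p p-odd k i (p ^ suc k + 1 ∸ i) (begin
  i + (p ^ suc k + 1 ∸ i)       ≡⟨ m+[n∸m]≡n i≤ ⟩
  p ^ suc k + 1                 ≡⟨ cong (_+ 1) (p^≡1+repdigit*2 p {p₂ p} p-odd (suc k)) ⟩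
  1 + (p₂ p + r * p) * 2 + 1    ≡⟨ solve 3 (λ h r p → con 1 :+ (h :+ r :* p) :* con 2 :+ con 1
                                              := (con 1 :+ h :+ r :* p) :* con 2) refl (p₂ p) r p ⟩
  (suc (p₂ p) + r * p) * 2      ∎)
  where
  open ≡-Reasoning
  1<p = nonTrivial⇒n>1 p {{prime⇒nonTrivial p-prime}}
  p-odd = trans (m≡m%n+[m/n]*n p 2) (cong (_+ p / 2 * 2) p%2≡1)
  r = repdigit p (p₂ p) k
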